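{- Let $\chi=\langle n\ n-1\ \cdots\ 1\rangle\in S_n$ and $\gamma=(0,1,2,\ldots,n)$. For every $\pi\in S_n$, $\overline{\pi^{\chi}}=\gamma\circ\chi\circ\overline{\pi}^{ -1}\circ\chi^{ -1}\circ\gamma^{ -1}$, i.e. $\overline{\pi^{\chi}}=((\overline{\pi}^{ -1})^\chi)^{\gamma}$.
   Context: Permutations are composed right to left; $\pi\in S_n$ is written $\langle \pi_1\ \cdots\ \pi_n\rangle$, $\pi_i=\pi(i)$, and identified with the permutation of $\{0,\ldots,n\}$ fixing $0$ (in particular $\chi$ fixes $0$). For $\pi\in S_n$, $\overline{\pi}=(0,1,2,\ldots,n)\circ(0,\pi_n,\pi_{n-1},\ldots,\pi_1)$, a permutation of $\{0,\ldots,n\}$. For permutations $\alpha,\beta$, $\alpha^\beta=\beta\circ\alpha\circ\beta^{ -1}$. -}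

module Defs where

-- Fin n = {0,…,n-1} encodes {1,…,n} via  k ↦ k+1.
--  * Permutations of {0,…,n} are  Perm (suc n) ; element 0 is  zero, element k ≥ 1
--    is  suc (k-1).  A  π ∈ S_n  is identified with  lift₀ π  (fixing 0).
--  * Composition is right to left:  (σ ⊙ τ) x = σ (τ x).
--  * Equality of permutations is pointwise equality  _≈_  (stdlib).

open import Data.Nat as ℕ using (ℕ; zero; suc)
open import Data.Fin using (Fin; zero; suc; toℕ; fromℕ; inject₁; lower₁)
open import Data.Fin.Properties
  using (toℕ-fromℕ; toℕ-injective; toℕ-inject₁-≢; lower₁-inject₁′; inject₁-lower₁; suc-injective)
open import Data.Fin.Permutation public
  using (Permutation′; _⟨$⟩ʳ_; _⟨$⟩ˡ_; _≈_; permutation; lift₀; flip; reverse; _∘ₚ_; inverseˡ; inverseʳ)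
open import Relation.Nullary using (yes; no; contradiction)
open import Relation.Binary.PropositionalEquality
open import Relation.Nullary using (¬_)

Perm : ℕ → Set
Perm n = Permutation′ n

infixr 9 _⊙_
_⊙_ : ∀ {n} → Perm n → Perm n → Perm n
σ ⊙ τ = τ ∘ₚ σ

infix 10 _⁻¹
_⁻¹ : ∀ {n} → Perm n → Perm n
σ ⁻¹ = flip σ

infix 8 _^_
_^_ : ∀ {n} → Perm n → Perm n → Perm n
α ^ β = β ⊙ α ⊙ β ⁻¹

-- χ = ⟨ n n-1 ⋯ 1 ⟩ ∈ S_n  (k ↦ n+1-k), i.e. 0-indexed i ↦ n-1-i
χ : ∀ n → Perm n
χ n = reverse

ι : ∀ {n} → Perm n → Perm (suc n)
ι = lift₀

-- γ = (0,1,2,…,n) on {0,…,n}:  k ↦ k+1 for k < n,  n ↦ 0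

γ-to : ∀ {n} → Fin (suc n) → Fin (suc n)
γ-to {n} i with n ℕ.≟ toℕ i
... | yes _ = zero
... | no ne = suc (lower₁ i ne)

γ-from : ∀ {n} → Fin (suc n) → Fin (suc n)
γ-from {n} zero    = fromℕ n
γ-from {n} (suc j) = inject₁ j

γ-to-from : ∀ {n} (x : Fin (suc n)) → γ-to (γ-from x) ≡ x
γ-to-from {n} zero with n ℕ.≟ toℕ (fromℕ n)
... | yes _ = refl
... | no ne = contradiction (sym (toℕ-fromℕ n)) ne
γ-to-from {n} (suc j) with n ℕ.≟ toℕ (inject₁ j)
... | yes p = contradiction p (toℕ-inject₁-≢ j)
... | no ne = cong suc (lower₁-inject₁′ j ne)

γ-from-to : ∀ {n} (x : Fin (suc n)) → γ-from (γ-to x) ≡ x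
γ-from-to {n} x with n ℕ.≟ toℕ x
... | yes p = toℕ-injective (trans (toℕ-fromℕ n) p)
... | no ne = inject₁-lower₁ x ne

γ : ∀ n → Perm (suc n)
γ n = permutation γ-to γ-from γ-to-from γ-from-to

-- The cycle (0, π_n, π_{n-1}, …, π_1) on {0,…,n}, for π ∈ S_n:
--   0 ↦ π_n,  π_k ↦ π_{k-1} (k ≥ 2),  π_1 ↦ 0.
-- (For n = 0 it is the trivial cycle (0), i.e. the identity.)

cyc-to : ∀ {n} → Perm n → Fin (suc n) → Fin (suc n)
cyc-to {zero}  π x = x
cyc-to {suc m} π zero = suc (π ⟨$⟩ʳ fromℕ m)
cyc-to {suc m} π (suc j) with π ⟨$⟩ˡ j
... | zero  = zero
... | suc k = suc (π ⟨$⟩ʳ inject₁ k)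

cyc-from : ∀ {n} → Perm n → Fin (suc n) → Fin (suc n)
cyc-from {zero}  π x = x
cyc-from {suc m} π zero = suc (π ⟨$⟩ʳ zero)
cyc-from {suc m} π (suc j) with m ℕ.≟ toℕ (π ⟨$⟩ˡ j)
... | yes _ = zero
... | no ne = suc (π ⟨$⟩ʳ suc (lower₁ (π ⟨$⟩ˡ j) ne))

cyc-to-from : ∀ {n} (π : Perm n) (x : Fin (suc n)) → cyc-to π (cyc-from π x) ≡ x
cyc-to-from {zero}  π x = refl
cyc-to-from {suc m} π zero rewrite inverseˡ π {zero} = refl
cyc-to-from {suc m} π (suc j) with m ℕ.≟ toℕ (π ⟨$⟩ˡ j)
... | yes p = cong suc (trans (cong (π ⟨$⟩ʳ_) (toℕ-injective (trans (toℕ-fromℕ m) p))) (inverseʳ π))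
... | no ne rewrite inverseˡ π {suc (lower₁ (π ⟨$⟩ˡ j) ne)} =
  cong suc (trans (cong (π ⟨$⟩ʳ_) (inject₁-lower₁ (π ⟨$⟩ˡ j) ne)) (inverseʳ π))

lower-eq : ∀ {m} {y : Fin (suc m)} {k : Fin m} (e : y ≡ inject₁ k) (ne : m ≢ toℕ y) →
           lower₁ y ne ≡ k
lower-eq refl ne = lower₁-inject₁′ _ ne

cyc-from-to : ∀ {n} (π : Perm n) (x : Fin (suc n)) → cyc-from π (cyc-to π x) ≡ x
cyc-from-to {zero}  π x = refl
cyc-from-to {suc m} π zero with m ℕ.≟ toℕ (π ⟨$⟩ˡ (π ⟨$⟩ʳ fromℕ m))
... | yes _ = refl
... | no ne = contradiction (trans (sym (toℕ-fromℕ m)) (cong toℕ (sym (inverseˡ π)))) ne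
cyc-from-to {suc m} π (suc j) with π ⟨$⟩ˡ j in eq
... | zero  = cong suc (trans (cong (π ⟨$⟩ʳ_) (sym eq)) (inverseʳ π))
... | suc k with m ℕ.≟ toℕ (π ⟨$⟩ˡ (π ⟨$⟩ʳ inject₁ k))
...   | yes p = contradiction (trans p (cong toℕ (inverseˡ π))) (toℕ-inject₁-≢ k)
...   | no ne = cong suc (trans (cong (λ z → π ⟨$⟩ʳ suc z) (lower-eq (inverseˡ π) ne))
                                (trans (cong (π ⟨$⟩ʳ_) (sym eq)) (inverseʳ π)))

cyc : ∀ {n} → Perm n → Perm (suc n)
cyc π = permutation (cyc-to π) (cyc-from π) (cyc-to-from π) (cyc-from-to π)

bar : ∀ {n} → Perm n → Perm (suc n)
bar {n} π = γ n ⊙ cyc π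

-- The cycle (0, π_n, …, π_1) is the relabelling of (0, n, …, 1) = γ⁻¹ by π, i.e. (γ⁻¹)^π,
-- so π̄ = γ ∘ (γ⁻¹)^π and π̄⁻¹ = γ^π ∘ γ⁻¹.  The involution χ (fixing 0) conjugates γ⁻¹ to γ,
-- hence the cycle of π^χ is (γ⁻¹)^(χπχ) = (γ^π)^χ, and γ⁻¹ χ γ⁻¹ = χ makes the right-hand
-- side γ χ γ^π γ⁻¹ χ γ⁻¹ collapse to the same permutation γ ∘ (γ^π)^χ.
module Submission where

open import Defs
open import Data.Nat using (zero; suc)
open import Data.Fin using (Fin; zero; suc; fromℕ; inject₁; opposite)
open import Data.Fin.Properties using (opposite-involutive)
open import Function using (_∘_)
open import Relation.Binary.PropositionalEquality

opposite-fromℕ : ∀ n → opposite {suc n} (fromℕ n) ≡ zero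
opposite-fromℕ zero    = refl
opposite-fromℕ (suc n) = cong inject₁ (opposite-fromℕ n)

opposite-inject₁ : ∀ {n} (i : Fin n) → opposite {suc n} (inject₁ i) ≡ suc (opposite i)
opposite-inject₁ {suc n} zero    = refl
opposite-inject₁ {suc n} (suc i) = cong inject₁ (opposite-inject₁ i)

χ̂ : ∀ {n} → Fin (suc n) → Fin (suc n)
χ̂ {n} x = ι (χ n) ⟨$⟩ʳ x

χ̂⁻¹≗χ̂ : ∀ {n} (x : Fin (suc n)) → ι (χ n) ⟨$⟩ˡ x ≡ χ̂ x
χ̂⁻¹≗χ̂ zero    = refl
χ̂⁻¹≗χ̂ (suc i) = refl

ι-^χ : ∀ {n} (π : Perm n) (x : Fin (suc n)) → ι (π ^ χ n) ⟨$⟩ʳ x ≡ χ̂ (ι π ⟨$⟩ʳ χ̂ x)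
ι-^χ π zero    = refl
ι-^χ π (suc i) = refl

ι-^χ⁻¹ : ∀ {n} (π : Perm n) (x : Fin (suc n)) → ι (π ^ χ n) ⟨$⟩ˡ x ≡ χ̂ (ι π ⟨$⟩ˡ χ̂ x)
ι-^χ⁻¹ π zero    = refl
ι-^χ⁻¹ π (suc i) = refl

χ̂-involutive : ∀ {n} (x : Fin (suc n)) → χ̂ (χ̂ x) ≡ x
χ̂-involutive zero    = refl
χ̂-involutive (suc i) = cong suc (opposite-involutive i)

-- γ-to-from supplies the values γ-to (fromℕ n) = zero and γ-to (inject₁ j) = suc j.
χ̂∘γ-from≗γ-to∘χ̂ : ∀ {n} (x : Fin (suc n)) → χ̂ (γ-from x) ≡ γ-to (χ̂ x)
χ̂∘γ-from≗γ-to∘χ̂ {zero}  zero = sym (γ-to-from zero)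
χ̂∘γ-from≗γ-to∘χ̂ {suc n} zero = begin
  suc (opposite (fromℕ n))  ≡⟨ cong suc (opposite-fromℕ n) ⟩
  suc zero                  ≡⟨ γ-to-from (suc zero) ⟨
  γ-to zero                 ∎
  where open ≡-Reasoning
χ̂∘γ-from≗γ-to∘χ̂ {suc n} (suc zero)    = sym (γ-to-from zero)
χ̂∘γ-from≗γ-to∘χ̂ {suc n} (suc (suc i)) = begin
  suc (opposite (inject₁ i))             ≡⟨ cong suc (opposite-inject₁ i) ⟩
  suc (suc (opposite i))                 ≡⟨ γ-to-from (suc (suc (opposite i))) ⟨
  γ-to (inject₁ (suc (opposite i)))      ∎
  where open ≡-Reasoning

χ̂-conjugates-γ-from : ∀ {n} (x : Fin (suc n)) → χ̂ (γ-from (χ̂ x)) ≡ γ-to x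
χ̂-conjugates-γ-from x = trans (χ̂∘γ-from≗γ-to∘χ̂ (χ̂ x)) (cong γ-to (χ̂-involutive x))

γ-from∘χ̂∘γ-from≗χ̂ : ∀ {n} (x : Fin (suc n)) → γ-from (χ̂ (γ-from x)) ≡ χ̂ x
γ-from∘χ̂∘γ-from≗χ̂ x = trans (cong γ-from (χ̂∘γ-from≗γ-to∘χ̂ x)) (γ-from-to (χ̂ x))

cyc-to-conjugate : ∀ {n} (π : Perm n) x → cyc-to π x ≡ ι π ⟨$⟩ʳ γ-from (ι π ⟨$⟩ˡ x)
cyc-to-conjugate {zero}  π zero = refl
cyc-to-conjugate {suc n} π zero = refl
cyc-to-conjugate {suc n} π (suc j) with π ⟨$⟩ˡ j
... | zero  = refl
... | suc k = refl

cyc-from-conjugate : ∀ {n} (π : Perm n) x → cyc-from π x ≡ ι π ⟨$⟩ʳ γ-to (ι π ⟨$⟩ˡ x)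
cyc-from-conjugate π x = begin
  cyc-from π x              ≡⟨ cong (cyc-from π) cyc-to-y ⟨
  cyc-from π (cyc-to π y)   ≡⟨ cyc-from-to π y ⟩
  y                         ∎
  where
  open ≡-Reasoning
  y = ι π ⟨$⟩ʳ γ-to (ι π ⟨$⟩ˡ x)
  cyc-to-y : cyc-to π y ≡ x
  cyc-to-y = begin
    cyc-to π y                                ≡⟨ cyc-to-conjugate π y ⟩
    ι π ⟨$⟩ʳ γ-from (ι π ⟨$⟩ˡ y)              ≡⟨ cong (λ z → ι π ⟨$⟩ʳ γ-from z) (inverseˡ (ι π) {γ-to (ι π ⟨$⟩ˡ x)}) ⟩
    ι π ⟨$⟩ʳ γ-from (γ-to (ι π ⟨$⟩ˡ x))       ≡⟨ cong (ι π ⟨$⟩ʳ_) (γ-from-to (ι π ⟨$⟩ˡ x)) ⟩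
    ι π ⟨$⟩ʳ (ι π ⟨$⟩ˡ x)                     ≡⟨ inverseʳ (ι π) {x} ⟩
    x                                         ∎

mainTheorem13 : ∀ n (π : Perm n) →
    bar (π ^ χ n) ≈ (((bar π) ⁻¹ ^ ι (χ n)) ^ γ n)
mainTheorem13 n π x = begin
  γ-to (cyc-to (π ^ χ n) x)                            ≡⟨ cong γ-to (cyc-to-conjugate (π ^ χ n) x) ⟩
  γ-to (ι (π ^ χ n) ⟨$⟩ʳ γ-from (ι (π ^ χ n) ⟨$⟩ˡ x))  ≡⟨ cong (γ-to ∘ (ι (π ^ χ n) ⟨$⟩ʳ_) ∘ γ-from) (ι-^χ⁻¹ π x) ⟩
  γ-to (ι (π ^ χ n) ⟨$⟩ʳ γ-from (χ̂ (ι π ⟨$⟩ˡ χ̂ x)))   ≡⟨ cong γ-to (ι-^χ π _) ⟩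
  γ-to (χ̂ (ι π ⟨$⟩ʳ χ̂ (γ-from (χ̂ (ι π ⟨$⟩ˡ χ̂ x)))))  ≡⟨ cong (γ-to ∘ χ̂ ∘ (ι π ⟨$⟩ʳ_)) (χ̂-conjugates-γ-from _) ⟩
  γ-to (χ̂ (ι π ⟨$⟩ʳ γ-to (ι π ⟨$⟩ˡ χ̂ x)))            ≡⟨ cong (γ-to ∘ χ̂) (cyc-from-conjugate π (χ̂ x)) ⟨
  γ-to (χ̂ (cyc-from π (χ̂ x)))                          ≡⟨ cong (γ-to ∘ χ̂ ∘ cyc-from π) (γ-from∘χ̂∘γ-from≗χ̂ x) ⟨
  γ-to (χ̂ (cyc-from π (γ-from (χ̂ (γ-from x)))))        ≡⟨ cong (γ-to ∘ χ̂ ∘ cyc-from π ∘ γ-from) (χ̂⁻¹≗χ̂ (γ-from x)) ⟨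
  γ-to (χ̂ (cyc-from π (γ-from (ι (χ n) ⟨$⟩ˡ γ-from x)))) ∎
  where open ≡-Reasoning
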